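{- Let $k\ge1$ be an integer. There exist $k$ intervals $[\alpha_i,\beta_i]$, $1\le i\le k$, such that for all $a_1,\dots,a_k$ with $a_i\in[\alpha_i,\beta_i]$: (1) $|a_i|\le1$ for all $i$; (2) $|\sum_{j=1}^ka_j|\le1$; (3) $\beta_i-\alpha_i\ge\frac{1}{4(k+1)^2}$ for all $i$; (4) $|a_i-a_j|\ge\frac{1}{4(k+1)^2}$ for all $i\ne j$; (5) $|a_i+\sum_{j=1}^ka_j|\ge\frac{1}{4(k+1)^2}$ for all $i$; (6) $|\{j\colon a_j\ge\frac14\}|\ge\frac{k+1}{5}$.
   Formalization: The endpoints α_i, β_i are taken in ℚ, and the numbers a_i range only over the rationals in $[\alpha_i,\beta_i]$. -}

module Defs where

open import Data.Nat as ℕ using (ℕ; suc)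
open import Data.Integer using (+_)
open import Data.Fin using (Fin)
open import Data.List using (List; foldr; filter; length; allFin; map)
open import Data.Rational using (ℚ; 0ℚ; _+_; _/_; _≤?_)

sumℚ : ∀ {k} → (Fin k → ℚ) → ℚ
sumℚ {k} a = foldr _+_ 0ℚ (map a (allFin k))

eps : ℕ → ℚ
eps k = + 1 / (4 ℕ.* suc k ℕ.^ 2)

countGeQuarter : ∀ {k} → (Fin k → ℚ) → ℕ
countGeQuarter {k} a = length (filter (λ j → (+ 1 / 4) ≤? a j) (allFin k))

{-# OPTIONS --safe #-}
module Submission where

-- Measure in units of 1/(4K), K = (k+1)², so that eps k is one unit, 1/4 is K units and 1 is
-- 4K units, and take every interval to be [c, c+1] units for an integer corner c.  The first
-- corner is 2K (the point 1/2); the others come in pairs -(j+1), j+1 for j = 3K, 3K+2, …, so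
-- they lie near ∓3/4, corners of equal sign differ by at least 2, and the corners of a pair
-- cancel.  Hence the corners sum to 2K, or to 2K plus one unmatched negative corner, so their
-- sum S lies in (-2K, 2K] and Σ aⱼ lies in [S, S+k] units: adding it to a point near 1/2 or
-- 3/4 stays at least a unit above 0, adding it to a point near -3/4 at least a unit below 0.
-- Every other interval is positive, so at least half of the points are ≥ 1/4.

open import Data.Bool using (true; false)
open import Data.Empty using (⊥-elim)
open import Data.Fin using (Fin; zero; suc; toℕ)
import Data.Fin.Properties as Fin
open import Data.Integer as ℤ using (ℤ; +_; -[1+_]; 0ℤ; 1ℤ; -1ℤ)
import Data.Integer.Properties as ℤ
open import Data.Integer.Tactic.RingSolver using (solve-∀)
open import Data.List using (List; []; _∷_; foldr; map; filter; length; tabulate; allFin)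
open import Data.List.Properties using (map-tabulate; length-tabulate; filter-accept)
open import Data.Nat as ℕ using (ℕ; zero; suc; z≤n; s≤s; parity)
import Data.Nat.Properties as ℕ
import Data.Nat.Tactic.RingSolver as ℕ-Solver
open import Data.Parity.Base using (0ℙ)
open import Data.Product using (Σ; _×_; _,_; proj₁; proj₂)
open import Data.Sum using (_⊎_; inj₁; inj₂; swap)
open import Function using (_∘_)
open import Relation.Binary.PropositionalEquality
open import Relation.Nullary using (does)
open import Relation.Unary using (Decidable)

open import Defs

module Corners where

  open import Data.Integer using (_≤_; _+_; -_)

  ∑ : List ℤ → ℤ
  ∑ = foldr _+_ 0ℤ

  Apart : ℤ → ℤ → Set
  Apart l l′ = l + + 2 ≤ l′ ⊎ l′ + + 2 ≤ l

  apart⇒gap : ∀ {l l′} → Apart l l′ → 1ℤ ≤ l + - (l′ + 1ℤ) ⊎ (l + 1ℤ) + - l′ ≤ -1ℤ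
  apart⇒gap {l} {l′} (inj₁ l+2≤l′) =
    inj₂ (ℤ.≤-trans (ℤ.+-monoʳ-≤ (l + 1ℤ) (ℤ.neg-mono-≤ l+2≤l′)) (ℤ.≤-reflexive (shift l)))
    where
    shift : ∀ a → (a + 1ℤ) + - (a + + 2) ≡ -1ℤ
    shift = solve-∀
  apart⇒gap {l} {l′} (inj₂ l′+2≤l) =
    inj₁ (ℤ.≤-trans (ℤ.≤-reflexive (sym (shift l′))) (ℤ.+-monoˡ-≤ (- (l′ + 1ℤ)) l′+2≤l))
    where
    shift : ∀ a → (a + + 2) + - (a + 1ℤ) ≡ 1ℤ
    shift = solve-∀

  neg-pos-apart : ∀ j {l l′} → l ≤ -[1+ j ] → + 1 ≤ l′ → l + + 2 ≤ l′
  neg-pos-apart j l≤-1-j 1≤l′ = ℤ.≤-trans (ℤ.+-monoˡ-≤ (+ 2) (ℤ.≤-trans l≤-1-j (ℤ.-≤- z≤n))) 1≤l′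

  neg-neg-apart : ∀ j {l} → l ≤ -[1+ suc (suc j) ] → l + + 2 ≤ -[1+ j ]
  neg-neg-apart j = ℤ.+-monoˡ-≤ (+ 2)

  -[1+m]+1≡-m : ∀ m → -[1+ m ] + 1ℤ ≡ - + m
  -[1+m]+1≡-m m = shift (+ m)
    where
    shift : ∀ x → - (1ℤ + x) + 1ℤ ≡ - x
    shift = solve-∀

  tailCorner : ℕ → ℕ → ℤ
  tailCorner j zero          = -[1+ j ]
  tailCorner j (suc zero)    = + suc j
  tailCorner j (suc (suc t)) = tailCorner (suc (suc j)) t

  tailCorner-sign : ∀ j t → + suc j ≤ tailCorner j t ⊎ tailCorner j t ≤ -[1+ j ]
  tailCorner-sign j zero          = inj₂ ℤ.≤-refl
  tailCorner-sign j (suc zero)    = inj₁ ℤ.≤-refl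
  tailCorner-sign j (suc (suc t)) with tailCorner-sign (suc (suc j)) t
  ... | inj₁ 3+j≤c  = inj₁ (ℤ.≤-trans (ℤ.+≤+ (ℕ.m≤n+m (suc j) 2)) 3+j≤c)
  ... | inj₂ c≤-3-j = inj₂ (ℤ.≤-trans c≤-3-j (ℤ.-≤- (ℕ.m≤n+m j 2)))

  tailCorner-bounds : ∀ j t → - + suc (j ℕ.+ t) ≤ tailCorner j t × tailCorner j t ≤ + (j ℕ.+ t)
  tailCorner-bounds j zero          = ℤ.-≤- (ℕ.m≤m+n j 0) , ℤ.-≤+
  tailCorner-bounds j (suc zero)    = ℤ.-≤+ , ℤ.+≤+ (ℕ.≤-reflexive (ℕ.+-comm 1 j))
  tailCorner-bounds j (suc (suc t)) rewrite ℕ.+-suc j (suc t) | ℕ.+-suc j t =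
    tailCorner-bounds (suc (suc j)) t

  tailCorner-odd : ∀ j t → parity (suc t) ≡ 0ℙ → + suc j ≤ tailCorner j t
  tailCorner-odd j (suc zero)    _    = ℤ.≤-refl
  tailCorner-odd j (suc (suc t)) even =
    ℤ.≤-trans (ℤ.+≤+ (ℕ.m≤n+m (suc j) 2)) (tailCorner-odd (suc (suc j)) t even)

  tailCorner-apart : ∀ j t t′ → t ≢ t′ → Apart (tailCorner j t) (tailCorner j t′)
  tailCorner-apart j zero          zero           t≢t′ = ⊥-elim (t≢t′ refl)
  tailCorner-apart j zero          (suc zero)     _    =
    inj₁ (neg-pos-apart j ℤ.≤-refl (ℤ.+≤+ (s≤s z≤n)))
  tailCorner-apart j zero          (suc (suc t′)) _ with tailCorner-sign (suc (suc j)) t′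
  ... | inj₁ 3+j≤c  = inj₁ (neg-pos-apart j ℤ.≤-refl (ℤ.≤-trans (ℤ.+≤+ (s≤s z≤n)) 3+j≤c))
  ... | inj₂ c≤-3-j = inj₂ (neg-neg-apart j c≤-3-j)
  tailCorner-apart j (suc zero)    zero           _    = swap (tailCorner-apart j zero (suc zero) (λ ()))
  tailCorner-apart j (suc zero)    (suc zero)     t≢t′ = ⊥-elim (t≢t′ refl)
  tailCorner-apart j (suc zero)    (suc (suc t′)) _ with tailCorner-sign (suc (suc j)) t′
  ... | inj₁ 3+j≤c  = inj₁ (ℤ.≤-trans (ℤ.+≤+ (ℕ.≤-reflexive (ℕ.+-comm (suc j) 2))) 3+j≤c)
  ... | inj₂ c≤-3-j = inj₂ (neg-pos-apart (suc (suc j)) c≤-3-j (ℤ.+≤+ (s≤s z≤n)))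
  tailCorner-apart j (suc (suc t)) zero           _    =
    swap (tailCorner-apart j zero (suc (suc t)) (λ ()))
  tailCorner-apart j (suc (suc t)) (suc zero)     _    =
    swap (tailCorner-apart j (suc zero) (suc (suc t)) (λ ()))
  tailCorner-apart j (suc (suc t)) (suc (suc t′)) t≢t′ =
    tailCorner-apart (suc (suc j)) t t′ (t≢t′ ∘ cong (2 ℕ.+_))

  tailSum : ℕ → ℕ → ℤ
  tailSum j m = ∑ (tabulate {n = m} (tailCorner j ∘ toℕ))

  tailSum-pair : ∀ j m → tailSum j (suc (suc m)) ≡ tailSum (suc (suc j)) m
  tailSum-pair j m = cancel (+ j) (tailSum (suc (suc j)) m)
    where
    cancel : ∀ x s → - (1ℤ + x) + ((1ℤ + x) + s) ≡ s
    cancel = solve-∀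

  tailSum-bounds : ∀ j m → - + (j ℕ.+ m) ≤ tailSum j m × tailSum j m ≤ 0ℤ
  tailSum-bounds j zero          = ℤ.neg-≤-pos , ℤ.≤-refl
  tailSum-bounds j (suc zero)    = ℤ.neg-mono-≤ (ℤ.+≤+ (ℕ.≤-reflexive (ℕ.+-comm 1 j))) , ℤ.-≤+
  tailSum-bounds j (suc (suc m))
    rewrite tailSum-pair j m | ℕ.+-suc j (suc m) | ℕ.+-suc j m = tailSum-bounds (suc (suc j)) m

  module _ (K : ℕ) where

    2K 3K : ℕ
    2K = K ℕ.+ K
    3K = 2K ℕ.+ K

    2K+2K≡4K : 2K ℕ.+ 2K ≡ 4 ℕ.* K
    2K+2K≡4K = lemma K
      where
      lemma : ∀ x → (x ℕ.+ x) ℕ.+ (x ℕ.+ x) ≡ 4 ℕ.* x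
      lemma = ℕ-Solver.solve-∀

    3K+K≡4K : 3K ℕ.+ K ≡ 4 ℕ.* K
    3K+K≡4K = lemma K
      where
      lemma : ∀ x → (x ℕ.+ x ℕ.+ x) ℕ.+ x ≡ 4 ℕ.* x
      lemma = ℕ-Solver.solve-∀

    corner : ℕ → ℤ
    corner zero    = + 2K
    corner (suc t) = tailCorner 3K t

    cornerSum : ℕ → ℤ
    cornerSum k = ∑ (map (corner ∘ toℕ) (allFin k))

    corner-bounds : ∀ i → suc i ℕ.≤ K → - + (4 ℕ.* K) ≤ corner i × corner i + 1ℤ ≤ + (4 ℕ.* K)
    corner-bounds zero    1≤K = ℤ.neg-≤-pos , ℤ.+≤+ 2K+1≤4K
      where
      open ℕ.≤-Reasoning
      2K+1≤4K : 2K ℕ.+ 1 ℕ.≤ 4 ℕ.* K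
      2K+1≤4K = begin
        2K ℕ.+ 1  ≤⟨ ℕ.+-monoʳ-≤ 2K (ℕ.≤-trans 1≤K (ℕ.m≤m+n K K)) ⟩
        2K ℕ.+ 2K ≡⟨ 2K+2K≡4K ⟩
        4 ℕ.* K   ∎
    corner-bounds (suc t) t+2≤K =
      ℤ.≤-trans (ℤ.neg-mono-≤ (ℤ.+≤+ (ℕ.≤-trans (ℕ.≤-reflexive (ℕ.+-comm 1 _)) 3K+t+1≤4K)))
                (proj₁ bounds) ,
      ℤ.≤-trans (ℤ.+-monoˡ-≤ 1ℤ (proj₂ bounds)) (ℤ.+≤+ 3K+t+1≤4K)
      where
      open ℕ.≤-Reasoning
      bounds = tailCorner-bounds 3K t
      3K+t+1≤4K : 3K ℕ.+ t ℕ.+ 1 ℕ.≤ 4 ℕ.* K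
      3K+t+1≤4K = begin
        3K ℕ.+ t ℕ.+ 1   ≡⟨ ℕ.+-assoc 3K t 1 ⟩
        3K ℕ.+ (t ℕ.+ 1) ≤⟨ ℕ.+-monoʳ-≤ 3K (ℕ.≤-trans (ℕ.≤-reflexive (ℕ.+-comm t 1))
                                                       (ℕ.≤-trans (ℕ.n≤1+n (suc t)) t+2≤K)) ⟩
        3K ℕ.+ K         ≡⟨ 3K+K≡4K ⟩
        4 ℕ.* K          ∎

    corner-even : ∀ i → parity i ≡ 0ℙ → + K ≤ corner i
    corner-even zero    _    = ℤ.+≤+ (ℕ.m≤m+n K K)
    corner-even (suc t) even = ℤ.≤-trans (ℤ.+≤+ (ℕ.m≤n+m K (suc 2K))) (tailCorner-odd 3K t even)

    corner-band : ∀ i → + 2K ≤ corner i ⊎ corner i + 1ℤ ≤ - + 3K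
    corner-band zero    = inj₁ ℤ.≤-refl
    corner-band (suc t) with tailCorner-sign 3K t
    ... | inj₁ 3K+1≤c  = inj₁ (ℤ.≤-trans (ℤ.+≤+ (ℕ.≤-trans (ℕ.m≤m+n 2K K) (ℕ.n≤1+n _))) 3K+1≤c)
    ... | inj₂ c≤-3K-1 = inj₂ (ℤ.≤-trans (ℤ.+-monoˡ-≤ 1ℤ c≤-3K-1) (ℤ.≤-reflexive (-[1+m]+1≡-m 3K)))

    corner-apart : 1 ℕ.≤ K → ∀ i i′ → i ≢ i′ → Apart (corner i) (corner i′)
    corner-apart _   zero    zero     i≢i′ = ⊥-elim (i≢i′ refl)
    corner-apart 1≤K zero    (suc t′) _ with tailCorner-sign 3K t′
    ... | inj₁ 3K+1≤c  = inj₁ (ℤ.≤-trans (ℤ.+≤+ 2K+2≤3K+1) 3K+1≤c)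
      where
      open ℕ.≤-Reasoning
      2K+2≤3K+1 : 2K ℕ.+ 2 ℕ.≤ suc 3K
      2K+2≤3K+1 = begin
        2K ℕ.+ 2       ≡⟨ ℕ.+-suc 2K 1 ⟩
        suc (2K ℕ.+ 1) ≤⟨ s≤s (ℕ.+-monoʳ-≤ 2K 1≤K) ⟩
        suc 3K         ∎
    ... | inj₂ c≤-3K-1 = inj₂ (neg-pos-apart 3K c≤-3K-1 (ℤ.+≤+ (ℕ.≤-trans 1≤K (ℕ.m≤m+n K K))))
    corner-apart 1≤K (suc t) zero     _    = swap (corner-apart 1≤K zero (suc t) (λ ()))
    corner-apart _   (suc t) (suc t′) i≢i′ = tailCorner-apart 3K t t′ (i≢i′ ∘ cong suc)

    cornerSum-split : ∀ r → cornerSum (suc r) ≡ + 2K + tailSum 3K r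
    cornerSum-split r = cong ∑ (map-tabulate {n = suc r} (λ i → i) (corner ∘ toℕ))

    -2K<cornerSum≤2K : ∀ r → suc r ℕ.≤ K → 1ℤ ≤ + 2K + cornerSum (suc r) × cornerSum (suc r) ≤ + 2K
    -2K<cornerSum≤2K r k≤K rewrite cornerSum-split r = lower , upper
      where
      T = tailSum 3K r
      T-bounds = tailSum-bounds 3K r
      upper : + 2K + T ≤ + 2K
      upper = ℤ.≤-trans (ℤ.+-monoʳ-≤ (+ 2K) (proj₂ T-bounds)) (ℤ.≤-reflexive (ℤ.+-identityʳ _))
      lower : 1ℤ ≤ + 2K + (+ 2K + T)
      lower = begin
        1ℤ                              ≡⟨ cancel (+ r) ⟨
        + suc r + - + r                 ≤⟨ ℤ.+-monoˡ-≤ (- + r) (ℤ.+≤+ k≤K) ⟩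
        + K + - + r                     ≡⟨ regroup (+ K) (+ r) ⟩
        + 2K + (+ 2K + - + (3K ℕ.+ r))  ≤⟨ ℤ.+-monoʳ-≤ (+ 2K) (ℤ.+-monoʳ-≤ (+ 2K) (proj₁ T-bounds)) ⟩
        + 2K + (+ 2K + T)               ∎
        where
        open ℤ.≤-Reasoning
        cancel : ∀ x → (1ℤ + x) + - x ≡ 1ℤ
        cancel = solve-∀
        regroup : ∀ a b → a + - b ≡ (a + a) + ((a + a) + - (a + a + a + b))
        regroup = solve-∀

    cornerSum-bounds : ∀ r → suc r ℕ.≤ K →
      - + (4 ℕ.* K) ≤ cornerSum (suc r) × cornerSum (suc r) + + suc r ≤ + (4 ℕ.* K)
    cornerSum-bounds r k≤K = lower , upper
      where
      S = cornerSum (suc r)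
      S-bounds = -2K<cornerSum≤2K r k≤K
      lower : - + (4 ℕ.* K) ≤ S
      lower = begin
        - + (4 ℕ.* K)       ≡⟨ cong (-_ ∘ +_) 2K+2K≡4K ⟨
        - + (2K ℕ.+ 2K)     ≤⟨ ℤ.neg-mono-≤ (ℤ.+≤+ (ℕ.m≤m+n 2K 2K)) ⟩
        - + 2K              ≡⟨ ℤ.+-identityʳ _ ⟨
        - + 2K + 0ℤ         ≤⟨ ℤ.+-monoʳ-≤ (- + 2K) (ℤ.≤-trans (ℤ.+≤+ z≤n) (proj₁ S-bounds)) ⟩
        - + 2K + (+ 2K + S) ≡⟨ cancel (+ 2K) S ⟩
        S                   ∎
        where
        open ℤ.≤-Reasoning
        cancel : ∀ a s → - a + (a + s) ≡ s
        cancel = solve-∀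
      upper : S + + suc r ≤ + (4 ℕ.* K)
      upper = ℤ.≤-trans (ℤ.+-monoˡ-≤ (+ suc r) (proj₂ S-bounds))
        (ℤ.+≤+ (ℕ.≤-trans (ℕ.+-monoʳ-≤ 2K (ℕ.≤-trans k≤K (ℕ.m≤m+n K K))) (ℕ.≤-reflexive 2K+2K≡4K)))

    corner+cornerSum-away : ∀ r i → suc (suc r) ℕ.≤ K →
      1ℤ ≤ corner i + cornerSum (suc r) ⊎ (corner i + 1ℤ) + (cornerSum (suc r) + + suc r) ≤ -1ℤ
    corner+cornerSum-away r i k<K = away (corner-band i)
      where
      open ℤ.≤-Reasoning
      S = cornerSum (suc r)
      S-bounds = -2K<cornerSum≤2K r (ℕ.≤-trans (ℕ.n≤1+n _) k<K)
      regroup : ∀ a b → - (a + a + a) + ((a + a) + b) ≡ - a + b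
      regroup = solve-∀
      cancel : ∀ x → - (1ℤ + x) + x ≡ -1ℤ
      cancel = solve-∀
      away : + 2K ≤ corner i ⊎ corner i + 1ℤ ≤ - + 3K →
             1ℤ ≤ corner i + S ⊎ (corner i + 1ℤ) + (S + + suc r) ≤ -1ℤ
      away (inj₁ 2K≤c)    = inj₁ (ℤ.≤-trans (proj₁ S-bounds) (ℤ.+-monoˡ-≤ S 2K≤c))
      away (inj₂ c+1≤-3K) = inj₂ (begin
        (corner i + 1ℤ) + (S + + suc r) ≤⟨ ℤ.+-mono-≤ c+1≤-3K (ℤ.+-monoˡ-≤ (+ suc r) (proj₂ S-bounds)) ⟩
        - + 3K + (+ 2K + + suc r)       ≡⟨ regroup (+ K) (+ suc r) ⟩
        - + K + + suc r                 ≤⟨ ℤ.+-monoˡ-≤ (+ suc r) (ℤ.neg-mono-≤ (ℤ.+≤+ k<K)) ⟩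
        - + suc (suc r) + + suc r       ≡⟨ cancel (+ suc r) ⟩
        -1ℤ                             ∎)

open Corners

module _ {A : Set} {P : A → Set} (P? : Decidable P) where

  length-filter-∷ : ∀ x xs → length (filter P? xs) ℕ.≤ length (filter P? (x ∷ xs))
  length-filter-∷ x xs with does (P? x)
  ... | true  = ℕ.n≤1+n _
  ... | false = ℕ.≤-refl

  ≤2*length-filter : ∀ {r} (f : Fin r → A) → (∀ i → parity (toℕ i) ≡ 0ℙ → P (f i)) →
                     r ℕ.≤ 2 ℕ.* length (filter P? (tabulate f))
  ≤2*length-filter {zero}        f Pf = z≤n
  ≤2*length-filter {suc zero}    f Pf = begin
    1                                      ≤⟨ s≤s z≤n ⟩
    2 ℕ.* 1                                ≡⟨ cong (λ ys → 2 ℕ.* length ys) (filter-accept P? (Pf zero refl)) ⟨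
    2 ℕ.* length (filter P? (f zero ∷ [])) ∎
    where open ℕ.≤-Reasoning
  ≤2*length-filter {suc (suc r)} f Pf = begin
    suc (suc r)                ≤⟨ s≤s (s≤s (≤2*length-filter (λ i → f (suc (suc i))) (λ i → Pf (suc (suc i))))) ⟩
    2 ℕ.+ 2 ℕ.* c              ≡⟨ ℕ.*-suc 2 c ⟨
    2 ℕ.* suc c                ≤⟨ ℕ.*-monoʳ-≤ 2 (s≤s (length-filter-∷ (f (suc zero)) rest)) ⟩
    2 ℕ.* suc (length (filter P? (f (suc zero) ∷ rest)))
                               ≡⟨ cong (λ ys → 2 ℕ.* length ys) (filter-accept P? (Pf zero refl)) ⟨
    2 ℕ.* length (filter P? (tabulate f)) ∎
    where
    open ℕ.≤-Reasoning
    rest = tabulate (λ i → f (suc (suc i)))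
    c = length (filter P? rest)

open import Data.Rational
open import Data.Rational.Properties
import Data.Rational.Unnormalised as ℚᵘ
import Data.Rational.Unnormalised.Properties as ℚᵘ

p≤∣p∣ : ∀ p → p ≤ ∣ p ∣
p≤∣p∣ p with ≤-total 0ℚ p
... | inj₁ 0≤p = ≤-reflexive (sym (0≤p⇒∣p∣≡p 0≤p))
... | inj₂ p≤0 = ≤-trans p≤0 (0≤∣p∣ p)

-p≤∣p∣ : ∀ p → - p ≤ ∣ p ∣
-p≤∣p∣ p = subst (- p ≤_) (∣-p∣≡∣p∣ p) (p≤∣p∣ (- p))

p≤q∧-p≤q⇒∣p∣≤q : ∀ {p q} → p ≤ q → - p ≤ q → ∣ p ∣ ≤ q
p≤q∧-p≤q⇒∣p∣≤q {p} p≤q -p≤q with ∣p∣≡p∨∣p∣≡-p p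
... | inj₁ ∣p∣≡p  = subst (_≤ _) (sym ∣p∣≡p) p≤q
... | inj₂ ∣p∣≡-p = subst (_≤ _) (sym ∣p∣≡-p) -p≤q

toℚᵘ-/ : ∀ i n .{{_ : ℕ.NonZero n}} → toℚᵘ (i / n) ℚᵘ.≃ ℚᵘ.mkℚᵘ i (ℕ.pred n)
toℚᵘ-/ i (suc n) = toℚᵘ-fromℚᵘ (ℚᵘ.mkℚᵘ i n)

/-mono-≤ : ∀ {i j} m n .{{_ : ℕ.NonZero m}} .{{_ : ℕ.NonZero n}} →
           i ℤ.* + n ℤ.≤ j ℤ.* + m → i / m ≤ j / n
/-mono-≤ {i} {j} m@(suc _) n@(suc _) i*n≤j*m = toℚᵘ-cancel-≤
  (ℚᵘ.≤-respˡ-≃ (ℚᵘ.≃-sym (toℚᵘ-/ i m)) (ℚᵘ.≤-respʳ-≃ (ℚᵘ.≃-sym (toℚᵘ-/ j n)) (ℚᵘ.*≤* i*n≤j*m)))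

/-homo-+ : ∀ i j n .{{_ : ℕ.NonZero n}} → (i ℤ.+ j) / n ≡ i / n + j / n
/-homo-+ i j n@(suc _) = toℚᵘ-injective (begin
  toℚᵘ ((i ℤ.+ j) / n)                           ≈⟨ toℚᵘ-/ (i ℤ.+ j) n ⟩
  ℚᵘ.mkℚᵘ (i ℤ.+ j) (ℕ.pred n)                    ≈⟨ ℚᵘ.*≡* (cross-multiply i j (+ n)) ⟩
  ℚᵘ.mkℚᵘ i (ℕ.pred n) ℚᵘ.+ ℚᵘ.mkℚᵘ j (ℕ.pred n) ≈⟨ ℚᵘ.+-cong (toℚᵘ-/ i n) (toℚᵘ-/ j n) ⟨
  toℚᵘ (i / n) ℚᵘ.+ toℚᵘ (j / n)                 ≈⟨ toℚᵘ-homo-+ (i / n) (j / n) ⟨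
  toℚᵘ (i / n + j / n)                           ∎)
  where
  open ℚᵘ.≃-Reasoning
  cross-multiply : ∀ a b c → (a ℤ.+ b) ℤ.* (c ℤ.* c) ≡ (a ℤ.* c ℤ.+ b ℤ.* c) ℤ.* c
  cross-multiply = solve-∀

/-homo‿- : ∀ i n .{{_ : ℕ.NonZero n}} → (ℤ.- i) / n ≡ - (i / n)
/-homo‿- i n@(suc _) = toℚᵘ-injective (begin
  toℚᵘ ((ℤ.- i) / n)        ≈⟨ toℚᵘ-/ (ℤ.- i) n ⟩
  ℚᵘ.- ℚᵘ.mkℚᵘ i (ℕ.pred n) ≈⟨ ℚᵘ.-‿cong (toℚᵘ-/ i n) ⟨
  ℚᵘ.- toℚᵘ (i / n)         ≈⟨ toℚᵘ-homo‿- (i / n) ⟨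
  toℚᵘ (- (i / n))          ∎)
  where open ℚᵘ.≃-Reasoning

[i+1]/n-i/n≡1/n : ∀ i n .{{_ : ℕ.NonZero n}} → (i ℤ.+ 1ℤ) / n - i / n ≡ + 1 / n
[i+1]/n-i/n≡1/n i n = begin
  (i ℤ.+ 1ℤ) / n - i / n       ≡⟨ cong (λ q → (i ℤ.+ 1ℤ) / n + q) (/-homo‿- i n) ⟨
  (i ℤ.+ 1ℤ) / n + (ℤ.- i) / n ≡⟨ /-homo-+ (i ℤ.+ 1ℤ) (ℤ.- i) n ⟨
  ((i ℤ.+ 1ℤ) ℤ.+ ℤ.- i) / n   ≡⟨ cong (_/ n) (cancel i) ⟩
  + 1 / n                      ∎
  where
  open ≡-Reasoning
  cancel : ∀ a → (a ℤ.+ 1ℤ) ℤ.+ ℤ.- a ≡ 1ℤ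
  cancel = solve-∀

1/4≤K/[4K] : ∀ K .{{_ : ℕ.NonZero (4 ℕ.* K)}} → + 1 / 4 ≤ + K / (4 ℕ.* K)
1/4≤K/[4K] K = /-mono-≤ {+ 1} {+ K} 4 (4 ℕ.* K) (ℤ.≤-reflexive (begin
  + 1 ℤ.* + (4 ℕ.* K) ≡⟨ ℤ.*-identityˡ (+ (4 ℕ.* K)) ⟩
  + (4 ℕ.* K)         ≡⟨ cong +_ (ℕ.*-comm 4 K) ⟩
  + (K ℕ.* 4)         ≡⟨ ℤ.pos-* K 4 ⟩
  + K ℤ.* + 4         ∎))
  where open ≡-Reasoning

k≤2c⇒[1+k]/5≤c : ∀ {k c} → 1 ℕ.≤ k → k ℕ.≤ 2 ℕ.* c → + suc k / 5 ≤ + c / 1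
k≤2c⇒[1+k]/5≤c {suc k} {zero}  _ ()
k≤2c⇒[1+k]/5≤c {k}     {suc c} _ k≤2c = /-mono-≤ {+ suc k} {+ suc c} 5 1
  (subst₂ ℤ._≤_ (ℤ.pos-* (suc k) 1) (ℤ.pos-* (suc c) 5) (ℤ.+≤+ (begin
    suc k ℕ.* 1                           ≡⟨ ℕ.*-identityʳ (suc k) ⟩
    suc k                                 ≤⟨ s≤s k≤2c ⟩
    suc (2 ℕ.* suc c)                     ≤⟨ ℕ.m≤m+n _ (3 ℕ.* c ℕ.+ 2) ⟩
    suc (2 ℕ.* suc c) ℕ.+ (3 ℕ.* c ℕ.+ 2) ≡⟨ ℕ-Solver.solve (c ∷ []) ⟩
    suc c ℕ.* 5                           ∎)))
  where open ℕ.≤-Reasoning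

module Scaled (n : ℕ) .{{_ : ℕ.NonZero n}} where

  infix 4 _∈[_,_]

  record _∈[_,_] (x : ℚ) (l u : ℤ) : Set where
    constructor _,_
    field
      lower : l / n ≤ x
      upper : x ≤ u / n

  open _∈[_,_] public

  /n-mono-≤ : ∀ {i j} → i ℤ.≤ j → i / n ≤ j / n
  /n-mono-≤ {i} {j} i≤j = /-mono-≤ {i} {j} n n (ℤ.*-monoʳ-≤-nonNeg (+ n) i≤j)

  ∈-+ : ∀ {x y l u l′ u′} → x ∈[ l , u ] → y ∈[ l′ , u′ ] → x + y ∈[ l ℤ.+ l′ , u ℤ.+ u′ ]
  ∈-+ {l = l} {u} {l′} {u′} (l≤x , x≤u) (l′≤y , y≤u′) =
    subst (_≤ _) (sym (/-homo-+ l l′ n)) (+-mono-≤ l≤x l′≤y) ,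
    subst (_ ≤_) (sym (/-homo-+ u u′ n)) (+-mono-≤ x≤u y≤u′)

  ∈-neg : ∀ {x l u} → x ∈[ l , u ] → - x ∈[ ℤ.- u , ℤ.- l ]
  ∈-neg {l = l} {u} (l≤x , x≤u) =
    subst (_≤ _) (sym (/-homo‿- u n)) (neg-antimono-≤ x≤u) ,
    subst (_ ≤_) (sym (/-homo‿- l n)) (neg-antimono-≤ l≤x)

  ∈-sum : ∀ {A : Set} (f : A → ℚ) (l : A → ℤ) → (∀ a → f a ∈[ l a , l a ℤ.+ 1ℤ ]) → ∀ xs →
          foldr _+_ 0ℚ (map f xs) ∈[ ∑ (map l xs) , ∑ (map l xs) ℤ.+ + length xs ]
  ∈-sum f l f∈ []       = ≤-reflexive (0/n≡0 n) , ≤-reflexive (sym (0/n≡0 n))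
  ∈-sum f l f∈ (a ∷ xs) = subst (λ u → _ ∈[ l a ℤ.+ ∑ (map l xs) , u ])
                                (regroup (l a) (∑ (map l xs)) (+ length xs))
                                (∈-+ (f∈ a) (∈-sum f l f∈ xs))
    where
    regroup : ∀ x s m → (x ℤ.+ 1ℤ) ℤ.+ (s ℤ.+ m) ≡ (x ℤ.+ s) ℤ.+ (1ℤ ℤ.+ m)
    regroup = solve-∀

  ∈⇒∣∣≤1 : ∀ {x l u} → ℤ.- + n ℤ.≤ l → u ℤ.≤ + n → x ∈[ l , u ] → ∣ x ∣ ≤ 1ℚ
  ∈⇒∣∣≤1 {x} {l} {u} -n≤l u≤n x∈ = p≤q∧-p≤q⇒∣p∣≤q
    (≤-trans (upper x∈) (≤-trans (/n-mono-≤ u≤n) n/n≤1))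
    (≤-trans (upper (∈-neg x∈)) (≤-trans (/n-mono-≤ -l≤n) n/n≤1))
    where
    -l≤n : ℤ.- l ℤ.≤ + n
    -l≤n = subst (ℤ.- l ℤ.≤_) (ℤ.neg-involutive (+ n)) (ℤ.neg-mono-≤ -n≤l)
    n/n≤1 : + n / n ≤ 1ℚ
    n/n≤1 = /-mono-≤ {+ n} {+ 1} n 1
      (ℤ.≤-reflexive (trans (ℤ.*-identityʳ (+ n)) (sym (ℤ.*-identityˡ (+ n)))))

  ∈⇒1/n≤∣∣ : ∀ {x l u} → 1ℤ ℤ.≤ l ⊎ u ℤ.≤ -1ℤ → x ∈[ l , u ] → + 1 / n ≤ ∣ x ∣
  ∈⇒1/n≤∣∣ {x} (inj₁ 1≤l)  x∈ = ≤-trans (/n-mono-≤ 1≤l) (≤-trans (lower x∈) (p≤∣p∣ x))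
  ∈⇒1/n≤∣∣ {x} (inj₂ u≤-1) x∈ =
    ≤-trans (/n-mono-≤ (ℤ.neg-mono-≤ u≤-1)) (≤-trans (lower (∈-neg x∈)) (-p≤∣p∣ x))

  ∈-apart : ∀ {x y l l′} → x ∈[ l , l ℤ.+ 1ℤ ] → y ∈[ l′ , l′ ℤ.+ 1ℤ ] → Apart l l′ →
            + 1 / n ≤ ∣ x - y ∣
  ∈-apart x∈ y∈ l#l′ = ∈⇒1/n≤∣∣ (apart⇒gap l#l′) (∈-+ x∈ (∈-neg y∈))

module Construction (r : ℕ) where

  k K : ℕ
  k = suc r
  K = suc k ℕ.^ 2

  open Scaled (4 ℕ.* K)

  k<K : suc k ℕ.≤ K
  k<K = ℕ.m≤m*n (suc k) (suc k ℕ.^ 1)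

  c : Fin k → ℤ
  c i = corner K (toℕ i)

  α β : Fin k → ℚ
  α i = c i / (4 ℕ.* K)
  β i = (c i ℤ.+ 1ℤ) / (4 ℕ.* K)

  α≤β : ∀ i → α i ≤ β i
  α≤β i = /n-mono-≤ (ℤ.i≤i+j (c i) 1ℤ)

  unit-width : ∀ i → eps k ≤ β i - α i
  unit-width i = ≤-reflexive (sym ([i+1]/n-i/n≡1/n (c i) (4 ℕ.* K)))

  module _ (a : Fin k → ℚ) (a∈ : ∀ i → α i ≤ a i × a i ≤ β i) where

    box : ∀ i → a i ∈[ c i , c i ℤ.+ 1ℤ ]
    box i = proj₁ (a∈ i) , proj₂ (a∈ i)

    sum-box : sumℚ a ∈[ cornerSum K k , cornerSum K k ℤ.+ + k ]
    sum-box = subst (λ m → sumℚ a ∈[ cornerSum K k , cornerSum K k ℤ.+ + m ])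
                    (length-tabulate (λ i → i)) (∈-sum a c box (allFin k))

    ∣a∣≤1 : ∀ i → ∣ a i ∣ ≤ 1ℚ
    ∣a∣≤1 i = ∈⇒∣∣≤1 (proj₁ bounds) (proj₂ bounds) (box i)
      where bounds = corner-bounds K (toℕ i) (ℕ.≤-trans (Fin.toℕ<n i) (ℕ.<⇒≤ k<K))

    ∣sum∣≤1 : ∣ sumℚ a ∣ ≤ 1ℚ
    ∣sum∣≤1 = ∈⇒∣∣≤1 (proj₁ bounds) (proj₂ bounds) sum-box
      where bounds = cornerSum-bounds K r (ℕ.<⇒≤ k<K)

    a-apart : ∀ i j → i ≢ j → eps k ≤ ∣ a i - a j ∣
    a-apart i j i≢j = ∈-apart (box i) (box j)
      (corner-apart K (ℕ.≤-trans (s≤s z≤n) k<K) (toℕ i) (toℕ j) (i≢j ∘ Fin.toℕ-injective))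

    a+sum-apart : ∀ i → eps k ≤ ∣ a i + sumℚ a ∣
    a+sum-apart i = ∈⇒1/n≤∣∣ (corner+cornerSum-away K r (toℕ i) k<K) (∈-+ (box i) sum-box)

    quarter≤a : ∀ i → parity (toℕ i) ≡ 0ℙ → + 1 / 4 ≤ a i
    quarter≤a i even =
      ≤-trans (1/4≤K/[4K] K) (≤-trans (/n-mono-≤ (corner-even K (toℕ i) even)) (lower (box i)))

    many-quarters : + (suc k) / 5 ≤ + countGeQuarter a / 1
    many-quarters = k≤2c⇒[1+k]/5≤c {c = countGeQuarter a} (s≤s z≤n)
      (≤2*length-filter (λ j → + 1 / 4 ≤? a j) (λ j → j) quarter≤a)

lemma4p9 : (k : ℕ) → 1 ℕ.≤ k →
    Σ (Fin k → ℚ) λ α → Σ (Fin k → ℚ) λ β →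
      ((i : Fin k) → α i ≤ β i) ×
      ((a : Fin k → ℚ) → ((i : Fin k) → α i ≤ a i × a i ≤ β i) →
        ((i : Fin k) → ∣ a i ∣ ≤ 1ℚ) ×
        (∣ sumℚ a ∣ ≤ 1ℚ) ×
        ((i : Fin k) → eps k ≤ β i - α i) ×
        ((i j : Fin k) → i ≢ j → eps k ≤ ∣ a i - a j ∣) ×
        ((i : Fin k) → eps k ≤ ∣ a i + sumℚ a ∣) ×
        (+ (suc k) / 5 ≤ + countGeQuarter a / 1))
lemma4p9 (suc r) _ = α , β , α≤β , λ a a∈ →
  ∣a∣≤1 a a∈ , ∣sum∣≤1 a a∈ , unit-width , a-apart a a∈ , a+sum-apart a a∈ , many-quarters a a∈
  where open Construction r
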